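{- Let $t$ be an LSC term and $R: t=C\langle r\rangle\to_{\tt dB} C\langle p\rangle = u$ with $r\to_{\tt dB} p$ at the root (i.e. $r=L\langle\lambda x.s\rangle q$ and $p=L\langle s[x\leftarrow q]\rangle$). Then: (1) (Projection) $R\!\downarrow: t\!\downarrow = C\!\downarrow\langle r\!\downarrow_C\rangle \to_\beta C\!\downarrow\langle p\!\downarrow_C\rangle = u\!\downarrow$ with $r\!\downarrow_C\to_\beta p\!\downarrow_C$ at the root; (2) (Minimality) if moreover $R$ is the LOU redex of $t$, then $R\!\downarrow$ is the leftmost-outermost $\beta$-redex of $t\!\downarrow$.
   Context: LSC terms: $t::= x\mid \lambda x.t\mid tu\mid t[x\leftarrow u]$ (explicit substitution binding $x$), modulo $\alpha$. Shallow contexts $C::=\langle\cdot\rangle\mid \lambda x.C\mid Ct\mid tC\mid C[x\leftarrow t]$; substitution contexts $L::=\langle\cdot\rangle\mid L[x\leftarrow t]$; applicative contexts $A::=C\langle L\,t\rangle$. Reduction: closure under shallow contexts of ${\tt dB}$: $(L\langle\lambda x.t\rangle)u\to L\langle t[x\leftarrow u]\rangle$ and ${\tt ls}$: $C\langle x\rangle[x\leftarrow u]\to C\langle u\rangle[x\leftarrow u]$ ($C$ not capturing $x$); compact form of ${\tt ls}$: $E\langle x\rangle\to E\langle u\rangle$ with $E=D\langle C[x\leftarrow u]\rangle$. Unfolding $x\!\downarrow=x$, $(tu)\!\downarrow=t\!\downarrow u\!\downarrow$, $(\lambda x.t)\!\downarrow=\lambda x.t\!\downarrow$, $(t[x\leftarrow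 u])\!\downarrow=t\!\downarrow\{x\leftarrow u\!\downarrow\}$; on contexts $\langle\cdot\rangle\!\downarrow=\langle\cdot\rangle$ and analogously ($(C[x\leftarrow t])\!\downarrow = C\!\downarrow\{x\leftarrow t\!\downarrow\}$, with $\langle\cdot\rangle\{x\leftarrow t\}=\langle\cdot\rangle$). Relative unfolding $t\!\downarrow_{\langle\cdot\rangle}=t\!\downarrow$, $t\!\downarrow_{uC}=t\!\downarrow_{Cu}=t\!\downarrow_{\lambda x.C}=t\!\downarrow_C$, $t\!\downarrow_{C[x\leftarrow u]}=t\!\downarrow_C\{x\leftarrow u\!\downarrow\}$. Useful redex: ${\tt dB}$-redex, or compact ${\tt ls}$-redex $C\langle x\rangle\to C\langle r\rangle$ with $r\!\downarrow_C$ containing a $\beta$-redex, or $r\!\downarrow_C$ an abstraction and $C$ applicative. Positions: ${\tt dB}$-redex (or $\beta$-redex) $C\langle L\langle\lambda x.t\rangle u\rangle$ has position $C$; compact ${\tt ls}$-redex $C\langle x\rangle\to C\langle u\rangle$ has position $C$. $C\prec_p t$ means $t=C\langle u\rangle$. $\prec_O$: $\langle\cdot\rangle\prec_O C$ for $C\neq\langle\cdot\rangle$, closed under $E\langle\cdot\rangle$. $\prec_L$: if $C\prec_p t$, $D\prec_p u$ then $Cu\prec_L tD$ and $C[x\leftarrow u]\prec_L t[x\leftarrow D]$, closed under $E\langle\cdot\rangle$. $\prec_{LO}=\prec_O\cup\prec_L$. The LOU redex is the $\prec_{LO}$-least useful redex; the leftmost-outermost $\beta$-redex of a $\lambda$-term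 is the $\prec_{LO}$-least $\beta$-redex. -}

module Defs where

open import Data.Nat using (ℕ; zero; suc; _+_; _<ᵇ_; _≡ᵇ_; pred)
open import Data.Bool using (if_then_else_)
open import Data.List using (List; []; _∷_; length)
open import Data.Product using (Σ; ∃; _×_; _,_)
open import Data.Sum using (_⊎_)
open import Relation.Binary.PropositionalEquality using (_≡_; _≢_)

-- Terms are represented with de Bruijn indices (this realises "modulo α").

data Λ : Set where
  lvar : ℕ → Λ
  llam : Λ → Λ
  lapp : Λ → Λ → Λ

shiftΛ : ℕ → ℕ → Λ → Λ
shiftΛ d c (lvar i)   = if i <ᵇ c then lvar i else lvar (i + d)
shiftΛ d c (llam a)   = llam (shiftΛ d (suc c) a)
shiftΛ d c (lapp a b) = lapp (shiftΛ d c a) (shiftΛ d c b)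

-- subΛ k s a : capture-avoiding meta-substitution a{k ← s}, removing
-- index k (indices above k are decremented); s lives in the scope of a
-- with index k removed.
subΛ : ℕ → Λ → Λ → Λ
subΛ k s (lvar i)   = if i <ᵇ k then lvar i else (if i ≡ᵇ k then s else lvar (pred i))
subΛ k s (llam a)   = llam (subΛ (suc k) (shiftΛ 1 0 s) a)
subΛ k s (lapp a b) = lapp (subΛ k s a) (subΛ k s b)

data LCtx : Set where
  lhole : LCtx
  llamC : LCtx → LCtx
  lappL : LCtx → Λ → LCtx
  lappR : Λ → LCtx → LCtx

lplug : LCtx → Λ → Λ
lplug lhole       a = a
lplug (llamC C)   a = llam (lplug C a)
lplug (lappL C b) a = lapp (lplug C a) b
lplug (lappR b C) a = lapp b (lplug C a)

_∘L_ : LCtx → LCtx → LCtx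
lhole     ∘L D = D
llamC C   ∘L D = llamC (C ∘L D)
lappL C b ∘L D = lappL (C ∘L D) b
lappR b C ∘L D = lappR b (C ∘L D)

subC : ℕ → Λ → LCtx → LCtx
subC k s lhole       = lhole
subC k s (llamC C)   = llamC (subC (suc k) (shiftΛ 1 0 s) C)
subC k s (lappL C b) = lappL (subC k s C) (subΛ k s b)
subC k s (lappR b C) = lappR (subΛ k s b) (subC k s C)

data RootBeta : Λ → Λ → Set where
  β : ∀ a b → RootBeta (lapp (llam a) b) (subΛ 0 b a)

BetaRedexAt : Λ → LCtx → Set
BetaRedexAt a D = Σ Λ λ b → Σ Λ λ c → a ≡ lplug D (lapp (llam b) c)

HasBetaRedex : Λ → Set
HasBetaRedex a = Σ LCtx λ D → BetaRedexAt a D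

IsAbs : Λ → Set
IsAbs a = Σ Λ λ b → a ≡ llam b

data _≺OΛ_ : LCtx → LCtx → Set where
  outer : ∀ E C → C ≢ lhole → E ≺OΛ (E ∘L C)

data _≺LΛ_ : LCtx → LCtx → Set where
  left : ∀ E C D a b → (Σ Λ λ s → a ≡ lplug C s) → (Σ Λ λ s → b ≡ lplug D s) →
         (E ∘L lappL C b) ≺LΛ (E ∘L lappR a D)

_≺LOΛ_ : LCtx → LCtx → Set
C ≺LOΛ D = C ≺OΛ D ⊎ C ≺LΛ D

IsLOBeta : Λ → LCtx → Set
IsLOBeta a D = BetaRedexAt a D × (∀ D′ → BetaRedexAt a D′ → D′ ≡ D ⊎ D ≺LOΛ D′)

-- LSC terms: es t u is t[x←u], binding index 0 in t

data Tm : Set where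
  var : ℕ → Tm
  lam : Tm → Tm
  app : Tm → Tm → Tm
  es  : Tm → Tm → Tm

shiftT : ℕ → ℕ → Tm → Tm
shiftT d c (var i)   = if i <ᵇ c then var i else var (i + d)
shiftT d c (lam t)   = lam (shiftT d (suc c) t)
shiftT d c (app t u) = app (shiftT d c t) (shiftT d c u)
shiftT d c (es t u)  = es (shiftT d (suc c) t) (shiftT d c u)

data Ctx : Set where
  hole : Ctx
  lamC : Ctx → Ctx
  appL : Ctx → Tm → Ctx
  appR : Tm → Ctx → Ctx
  esC  : Ctx → Tm → Ctx

plug : Ctx → Tm → Tm
plug hole       t = t
plug (lamC C)   t = lam (plug C t)
plug (appL C u) t = app (plug C t) u
plug (appR u C) t = app u (plug C t)
plug (esC C u)  t = es (plug C t) u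

_∘C_ : Ctx → Ctx → Ctx
hole     ∘C D = D
lamC C   ∘C D = lamC (C ∘C D)
appL C u ∘C D = appL (C ∘C D) u
appR u C ∘C D = appR u (C ∘C D)
esC C u  ∘C D = esC (C ∘C D) u

depth : Ctx → ℕ
depth hole       = 0
depth (lamC C)   = suc (depth C)
depth (appL C _) = depth C
depth (appR _ C) = depth C
depth (esC C _)  = suc (depth C)

ldepth : Ctx → ℕ
ldepth hole       = 0
ldepth (lamC C)   = suc (ldepth C)
ldepth (appL C _) = ldepth C
ldepth (appR _ C) = ldepth C
ldepth (esC C _)  = ldepth C

-- substitution contexts L ::= ⟨·⟩ | L[x←t]; the list u ∷ L stands for L[x←u]
SubCtx : Set
SubCtx = List Tm

toCtx : SubCtx → Ctx
toCtx []      = hole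
toCtx (u ∷ L) = esC (toCtx L) u

-- dB redex (L⟨λx.s⟩) q and its contractum L⟨s[x←q]⟩ (q moves under L)
dBRedex : SubCtx → Tm → Tm → Tm
dBRedex L s q = app (plug (toCtx L) (lam s)) q

dBContractum : SubCtx → Tm → Tm → Tm
dBContractum L s q = plug (toCtx L) (es s (shiftT (length L) 0 q))

_↓ : Tm → Λ
var i ↓   = lvar i
lam t ↓   = llam (t ↓)
app t u ↓ = lapp (t ↓) (u ↓)
es t u ↓  = subΛ 0 (u ↓) (t ↓)

_↓C : Ctx → LCtx
hole ↓C     = lhole
lamC C ↓C   = llamC (C ↓C)
appL C t ↓C = lappL (C ↓C) (t ↓)
appR t C ↓C = lappR (t ↓) (C ↓C)
esC C t ↓C  = subC 0 (t ↓) (C ↓C)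

_↓[_] : Tm → Ctx → Λ
t ↓[ hole ]     = t ↓
t ↓[ lamC C ]   = t ↓[ C ]
t ↓[ appL C _ ] = t ↓[ C ]
t ↓[ appR _ C ] = t ↓[ C ]
t ↓[ esC C u ]  = subΛ (ldepth C) (shiftΛ (ldepth C) 0 (u ↓)) (t ↓[ C ])

Applicative : Ctx → Set
Applicative C = Σ Ctx λ D → Σ SubCtx λ L → Σ Tm λ t → C ≡ D ∘C appL (toCtx L) t

-- compact ls-redex at position C: t = D⟨C′[x←u]⟩⟨x⟩, replaced by r (= u moved into scope)
LsRedexAt : Tm → Ctx → Tm → Set
LsRedexAt t C r = Σ Ctx λ D → Σ Ctx λ C′ → Σ Tm λ u →
  C ≡ D ∘C esC C′ u × t ≡ plug C (var (depth C′)) × r ≡ shiftT (suc (depth C′)) 0 u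

DBRedexAt : Tm → Ctx → Set
DBRedexAt t C = Σ SubCtx λ L → Σ Tm λ s → Σ Tm λ q → t ≡ plug C (dBRedex L s q)

data UsefulAt (t : Tm) (C : Ctx) : Set where
  dB : DBRedexAt t C → UsefulAt t C
  ls : ∀ r → LsRedexAt t C r →
       (HasBetaRedex (r ↓[ C ]) ⊎ (IsAbs (r ↓[ C ]) × Applicative C)) → UsefulAt t C

data _≺O_ : Ctx → Ctx → Set where
  outer : ∀ E C → C ≢ hole → E ≺O (E ∘C C)

data _≺L_ : Ctx → Ctx → Set where
  left : ∀ E C D t u → (Σ Tm λ s → t ≡ plug C s) → (Σ Tm λ s → u ≡ plug D s) →
         (E ∘C appL C u) ≺L (E ∘C appR t D)

_≺LO_ : Ctx → Ctx → Set
C ≺LO D = C ≺O D ⊎ C ≺L D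

IsLOU : Tm → Ctx → Set
IsLOU t C = UsefulAt t C × (∀ C′ → UsefulAt t C′ → C′ ≡ C ⊎ C ≺LO C′)

-- Unfolding commutes with plugging, C⟨r⟩↓ = C↓⟨r↓_C⟩, and relative to C the dB-redex
-- L⟨λx.s⟩q unfolds to (λx.s↓)(q↓) while L⟨s[x←q]⟩ unfolds to s↓{x←q↓}: the substitutions of L
-- act on s as they do under the binder of L⟨λx.·⟩, and not at all on q, which was shifted past L. For minimality, every β-redex of t↓ is traced back to a useful redex of
-- t: either it lies inside the unfolding of that redex, or an explicit substitution places an
-- abstraction at the head of an applicative context, and that ls-redex is useful. The LOU redex
-- is equal to, outer to or left of that useful redex, so its unfolded position is equal to, outer
-- to or left of the β-redex.

module Submission where

open import Defs
open import Data.Nat using (ℕ; zero; suc; _+_; _<ᵇ_; _≡ᵇ_; pred; _<_; _≤_; z≤n; s≤s; _<?_)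
open import Data.Nat.Properties
open import Data.Bool using (true; false)
open import Data.List using ([]; _∷_; length)
open import Data.Product using (Σ; _×_; _,_; proj₁; proj₂)
open import Data.Sum using (_⊎_; inj₁; inj₂)
import Data.Sum as Sum
open import Data.Empty using (⊥-elim)
open import Relation.Nullary using (¬_; yes; no)
open import Relation.Binary.Definitions using (tri<; tri≈; tri>)
open import Relation.Binary.PropositionalEquality
open ≡-Reasoning

-- de Bruijn arithmetic

<ᵇ-true : ∀ {m n} → m < n → (m <ᵇ n) ≡ true
<ᵇ-true {m} {n} m<n with m <ᵇ n | <⇒<ᵇ m<n
... | true | _ = refl

<ᵇ-false : ∀ {m n} → n ≤ m → (m <ᵇ n) ≡ false
<ᵇ-false {m} {n} n≤m with m <ᵇ n | <ᵇ⇒< m n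
... | false | _   = refl
... | true  | m<n = ⊥-elim (<⇒≱ (m<n _) n≤m)

≡ᵇ-refl : ∀ n → (n ≡ᵇ n) ≡ true
≡ᵇ-refl zero    = refl
≡ᵇ-refl (suc n) = ≡ᵇ-refl n

≡ᵇ-false : ∀ {m n} → m ≢ n → (m ≡ᵇ n) ≡ false
≡ᵇ-false {m} {n} m≢n with m ≡ᵇ n | ≡ᵇ⇒≡ m n
... | false | _   = refl
... | true  | m≡n = ⊥-elim (m≢n (m≡n _))

subΛ-var< : ∀ {k} s {i} → i < k → subΛ k s (lvar i) ≡ lvar i
subΛ-var< s i<k rewrite <ᵇ-true i<k = refl

subΛ-var≡ : ∀ k s → subΛ k s (lvar k) ≡ s
subΛ-var≡ k s rewrite <ᵇ-false (≤-refl {k}) | ≡ᵇ-refl k = refl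

subΛ-var> : ∀ {k} s {i} → k < i → subΛ k s (lvar i) ≡ lvar (pred i)
subΛ-var> s k<i rewrite <ᵇ-false (<⇒≤ k<i) | ≡ᵇ-false (>⇒≢ k<i) = refl

shiftΛ-zero : ∀ c a → shiftΛ 0 c a ≡ a
shiftΛ-zero c (lvar i) with i <? c
... | yes i<c rewrite <ᵇ-true i<c = refl
... | no i≮c rewrite <ᵇ-false (≮⇒≥ i≮c) | +-identityʳ i = refl
shiftΛ-zero c (llam a)   = cong llam (shiftΛ-zero (suc c) a)
shiftΛ-zero c (lapp a b) = cong₂ lapp (shiftΛ-zero c a) (shiftΛ-zero c b)

shiftΛ-shiftΛ : ∀ a b c c′ y → c ≤ c′ → c′ ≤ c + b → shiftΛ a c′ (shiftΛ b c y) ≡ shiftΛ (a + b) c y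
shiftΛ-shiftΛ a b c c′ (lvar i) c≤c′ c′≤c+b with i <? c
... | yes i<c rewrite <ᵇ-true i<c | <ᵇ-true (<-≤-trans i<c c≤c′) = refl
... | no i≮c rewrite <ᵇ-false (≮⇒≥ i≮c) | <ᵇ-false (≤-trans c′≤c+b (+-monoˡ-≤ b (≮⇒≥ i≮c)))
  = cong lvar (trans (+-assoc i b a) (cong (i +_) (+-comm b a)))
shiftΛ-shiftΛ a b c c′ (llam y) c≤c′ c′≤c+b =
  cong llam (shiftΛ-shiftΛ a b (suc c) (suc c′) y (s≤s c≤c′) (s≤s c′≤c+b))
shiftΛ-shiftΛ a b c c′ (lapp y z) c≤c′ c′≤c+b =
  cong₂ lapp (shiftΛ-shiftΛ a b c c′ y c≤c′ c′≤c+b) (shiftΛ-shiftΛ a b c c′ z c≤c′ c′≤c+b)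

subΛ-shiftΛ : ∀ m c k v y → c ≤ k → k ≤ c + m → subΛ k v (shiftΛ (suc m) c y) ≡ shiftΛ m c y
subΛ-shiftΛ m c k v (lvar i) c≤k k≤c+m with i <? c
... | yes i<c rewrite <ᵇ-true i<c = subΛ-var< v (<-≤-trans i<c c≤k)
... | no i≮c rewrite <ᵇ-false (≮⇒≥ i≮c) | +-suc i m =
  subΛ-var> v (s≤s (≤-trans k≤c+m (+-monoˡ-≤ m (≮⇒≥ i≮c))))
subΛ-shiftΛ m c k v (llam y) c≤k k≤c+m =
  cong llam (subΛ-shiftΛ m (suc c) (suc k) (shiftΛ 1 0 v) y (s≤s c≤k) (s≤s k≤c+m))
subΛ-shiftΛ m c k v (lapp y z) c≤k k≤c+m =
  cong₂ lapp (subΛ-shiftΛ m c k v y c≤k k≤c+m) (subΛ-shiftΛ m c k v z c≤k k≤c+m)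

shiftΛ-comm : ∀ a d c′ c v → c′ ≤ c → shiftΛ a c′ (shiftΛ d c v) ≡ shiftΛ d (a + c) (shiftΛ a c′ v)
shiftΛ-comm a d c′ c (lvar i) c′≤c with i <? c′ | i <? c
... | yes i<c′ | _
  rewrite <ᵇ-true (<-≤-trans i<c′ c′≤c) | <ᵇ-true i<c′ | <ᵇ-true (≤-trans (<-≤-trans i<c′ c′≤c) (m≤n+m c a))
  = refl
... | no i≮c′ | yes i<c
  rewrite <ᵇ-true i<c | <ᵇ-false (≮⇒≥ i≮c′) | <ᵇ-true (subst (i + a <_) (+-comm c a) (+-monoˡ-< a i<c))
  = refl
... | no i≮c′ | no i≮c
  rewrite <ᵇ-false (≮⇒≥ i≮c) | <ᵇ-false (≤-trans (≮⇒≥ i≮c′) (m≤m+n i d)) | <ᵇ-false (≮⇒≥ i≮c′)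
        | <ᵇ-false (subst (_≤ i + a) (+-comm c a) (+-monoˡ-≤ a (≮⇒≥ i≮c)))
  = cong lvar (trans (+-assoc i d a) (trans (cong (i +_) (+-comm d a)) (sym (+-assoc i a d))))
shiftΛ-comm a d c′ c (llam v) c′≤c =
  cong llam (trans (shiftΛ-comm a d (suc c′) (suc c) v (s≤s c′≤c))
                   (cong (λ e → shiftΛ d e (shiftΛ a (suc c′) v)) (+-suc a c)))
shiftΛ-comm a d c′ c (lapp v w) c′≤c = cong₂ lapp (shiftΛ-comm a d c′ c v c′≤c) (shiftΛ-comm a d c′ c w c′≤c)

shiftΛ-subΛ-≤ : ∀ c k V W → c ≤ k → shiftΛ 1 c (subΛ k V W) ≡ subΛ (suc k) (shiftΛ 1 c V) (shiftΛ 1 c W)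
shiftΛ-subΛ-≤ c k V (lvar i) c≤k with <-cmp i k | i <? c
... | tri< i<k _ _ | yes i<c rewrite <ᵇ-true i<k | <ᵇ-true i<c | <ᵇ-true (m<n⇒m<1+n i<k) = refl
... | tri< i<k _ _ | no i≮c rewrite <ᵇ-true i<k | <ᵇ-false (≮⇒≥ i≮c) | +-comm i 1 =
  sym (subΛ-var< _ (s≤s i<k))
... | tri≈ _ refl _ | _ rewrite <ᵇ-false c≤k | +-comm i 1 =
  trans (cong (shiftΛ 1 c) (subΛ-var≡ i V)) (sym (subΛ-var≡ (suc i) _))
shiftΛ-subΛ-≤ c k V (lvar (suc i)) c≤k | tri> _ _ (s≤s k≤i) | _
  rewrite subΛ-var> V (s≤s k≤i) | <ᵇ-false (≤-trans c≤k k≤i) | <ᵇ-false (m≤n⇒m≤1+n (≤-trans c≤k k≤i)) | +-comm i 1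
  = sym (subΛ-var> _ (s≤s (s≤s k≤i)))
shiftΛ-subΛ-≤ c k V (llam W) c≤k =
  cong llam (trans (shiftΛ-subΛ-≤ (suc c) (suc k) (shiftΛ 1 0 V) W (s≤s c≤k))
                   (cong (λ U → subΛ (suc (suc k)) U (shiftΛ 1 (suc c) W)) (sym (shiftΛ-comm 1 1 0 c V z≤n))))
shiftΛ-subΛ-≤ c k V (lapp W X) c≤k = cong₂ lapp (shiftΛ-subΛ-≤ c k V W c≤k) (shiftΛ-subΛ-≤ c k V X c≤k)

shiftΛ-subΛ-≥ : ∀ d k c V W → k ≤ c → shiftΛ d c (subΛ k V W) ≡ subΛ k (shiftΛ d c V) (shiftΛ d (suc c) W)
shiftΛ-subΛ-≥ d k c V (lvar i) k≤c with <-cmp i k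
... | tri< i<k _ _
  rewrite subΛ-var< V i<k | <ᵇ-true (<-≤-trans i<k k≤c) | <ᵇ-true (m<n⇒m<1+n (<-≤-trans i<k k≤c))
  = sym (subΛ-var< _ i<k)
... | tri≈ _ refl _ rewrite subΛ-var≡ i V | <ᵇ-true (s≤s k≤c) = sym (subΛ-var≡ i _)
shiftΛ-subΛ-≥ d k c V (lvar (suc i)) k≤c | tri> _ _ (s≤s k≤i) with i <? c
... | yes i<c rewrite subΛ-var> V (s≤s k≤i) | <ᵇ-true i<c = sym (subΛ-var> _ (s≤s k≤i))
... | no i≮c rewrite subΛ-var> V (s≤s k≤i) | <ᵇ-false (≮⇒≥ i≮c) =
  sym (subΛ-var> _ (s≤s (≤-trans k≤i (m≤m+n i d))))
shiftΛ-subΛ-≥ d k c V (llam W) k≤c =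
  cong llam (trans (shiftΛ-subΛ-≥ d (suc k) (suc c) (shiftΛ 1 0 V) W (s≤s k≤c))
                   (cong (λ U → subΛ (suc k) U (shiftΛ d (suc (suc c)) W)) (sym (shiftΛ-comm 1 d 0 c V z≤n))))
shiftΛ-subΛ-≥ d k c V (lapp W X) k≤c = cong₂ lapp (shiftΛ-subΛ-≥ d k c V W k≤c) (shiftΛ-subΛ-≥ d k c V X k≤c)

subΛ-subΛ : ∀ j k V W a →
  subΛ (j + k) V (subΛ j W a) ≡ subΛ j (subΛ (j + k) V W) (subΛ (suc (j + k)) (shiftΛ 1 j V) a)
subΛ-subΛ j k V W (lvar i) with <-cmp i j
... | tri< i<j _ _
  rewrite subΛ-var< W i<j | subΛ-var< V (≤-trans i<j (m≤m+n j k))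
        | subΛ-var< (shiftΛ 1 j V) (m<n⇒m<1+n (≤-trans i<j (m≤m+n j k)))
  = sym (subΛ-var< _ i<j)
... | tri≈ _ refl _ rewrite subΛ-var≡ i W | subΛ-var< (shiftΛ 1 i V) (s≤s (m≤m+n i k)) = sym (subΛ-var≡ i _)
subΛ-subΛ j k V W (lvar (suc i)) | tri> _ _ j<1+i with <-cmp i (j + k)
... | tri< i<j+k _ _ rewrite subΛ-var> W j<1+i | subΛ-var< V i<j+k | subΛ-var< (shiftΛ 1 j V) (s≤s i<j+k)
  = sym (subΛ-var> _ j<1+i)
... | tri≈ _ refl _ rewrite subΛ-var> W j<1+i | subΛ-var≡ (j + k) V | subΛ-var≡ (suc (j + k)) (shiftΛ 1 j V)
  = sym (trans (subΛ-shiftΛ 0 j j _ V ≤-refl (m≤m+n j 0)) (shiftΛ-zero j V))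
... | tri> _ _ j+k<i rewrite subΛ-var> W j<1+i | subΛ-var> V j+k<i | subΛ-var> (shiftΛ 1 j V) (s≤s j+k<i)
  = sym (subΛ-var> _ (<-≤-trans (s≤s (m≤m+n j k)) j+k<i))
subΛ-subΛ j k V W (llam a) =
  cong llam (trans (subΛ-subΛ (suc j) k (shiftΛ 1 0 V) (shiftΛ 1 0 W) a)
    (cong₂ (λ V′ U → subΛ (suc j) V′ (subΛ (suc (suc (j + k))) U a))
      (sym (shiftΛ-subΛ-≤ 0 (j + k) V W z≤n)) (sym (shiftΛ-comm 1 1 0 j V z≤n))))
subΛ-subΛ j k V W (lapp a b) = cong₂ lapp (subΛ-subΛ j k V W a) (subΛ-subΛ j k V W b)

↓-shiftT : ∀ d c t → shiftT d c t ↓ ≡ shiftΛ d c (t ↓)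
↓-shiftT d c (var i) with i <? c
... | yes i<c rewrite <ᵇ-true i<c = refl
... | no i≮c rewrite <ᵇ-false (≮⇒≥ i≮c) = refl
↓-shiftT d c (lam t)   = cong llam (↓-shiftT d (suc c) t)
↓-shiftT d c (app t u) = cong₂ lapp (↓-shiftT d c t) (↓-shiftT d c u)
↓-shiftT d c (es t u)  =
  trans (cong₂ (subΛ 0) (↓-shiftT d c u) (↓-shiftT d (suc c) t)) (sym (shiftΛ-subΛ-≥ d 0 c (u ↓) (t ↓) z≤n))

lam-injective : ∀ {t u} → lam t ≡ lam u → t ≡ u
lam-injective refl = refl

app-injectiveˡ : ∀ {t t′ u u′} → app t u ≡ app t′ u′ → t ≡ t′
app-injectiveˡ refl = refl

app-injectiveʳ : ∀ {t t′ u u′} → app t u ≡ app t′ u′ → u ≡ u′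
app-injectiveʳ refl = refl

es-injectiveˡ : ∀ {t t′ u u′} → es t u ≡ es t′ u′ → t ≡ t′
es-injectiveˡ refl = refl

llam-injective : ∀ {a b} → llam a ≡ llam b → a ≡ b
llam-injective refl = refl

lapp-injectiveˡ : ∀ {a a′ b b′} → lapp a b ≡ lapp a′ b′ → a ≡ a′
lapp-injectiveˡ refl = refl

lapp-injectiveʳ : ∀ {a a′ b b′} → lapp a b ≡ lapp a′ b′ → b ≡ b′
lapp-injectiveʳ refl = refl

lamC-injective : ∀ {A B} → lamC A ≡ lamC B → A ≡ B
lamC-injective refl = refl

appL-injective : ∀ {A B t u} → appL A t ≡ appL B u → A ≡ B × t ≡ u
appL-injective refl = refl , refl

appR-injective : ∀ {A B t u} → appR t A ≡ appR u B → t ≡ u × A ≡ B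
appR-injective refl = refl , refl

esC-injective : ∀ {A B t u} → esC A t ≡ esC B u → A ≡ B × t ≡ u
esC-injective refl = refl , refl

∘C-identityʳ : ∀ C → C ∘C hole ≡ C
∘C-identityʳ hole       = refl
∘C-identityʳ (lamC C)   = cong lamC (∘C-identityʳ C)
∘C-identityʳ (appL C t) = cong (λ D → appL D t) (∘C-identityʳ C)
∘C-identityʳ (appR t C) = cong (appR t) (∘C-identityʳ C)
∘C-identityʳ (esC C t)  = cong (λ D → esC D t) (∘C-identityʳ C)

∘C-assoc : ∀ A B C → (A ∘C B) ∘C C ≡ A ∘C (B ∘C C)
∘C-assoc hole       B C = refl
∘C-assoc (lamC A)   B C = cong lamC (∘C-assoc A B C)
∘C-assoc (appL A t) B C = cong (λ D → appL D t) (∘C-assoc A B C)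
∘C-assoc (appR t A) B C = cong (appR t) (∘C-assoc A B C)
∘C-assoc (esC A t)  B C = cong (λ D → esC D t) (∘C-assoc A B C)

plug-∘C : ∀ A B t → plug (A ∘C B) t ≡ plug A (plug B t)
plug-∘C hole       B t = refl
plug-∘C (lamC A)   B t = cong lam (plug-∘C A B t)
plug-∘C (appL A u) B t = cong (λ s → app s u) (plug-∘C A B t)
plug-∘C (appR u A) B t = cong (app u) (plug-∘C A B t)
plug-∘C (esC A u)  B t = cong (λ s → es s u) (plug-∘C A B t)

plug-injective : ∀ C {t u} → plug C t ≡ plug C u → t ≡ u
plug-injective hole       e = e
plug-injective (lamC C)   e = plug-injective C (lam-injective e)
plug-injective (appL C _) e = plug-injective C (app-injectiveˡ e)
plug-injective (appR _ C) e = plug-injective C (app-injectiveʳ e)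
plug-injective (esC C _)  e = plug-injective C (es-injectiveˡ e)

ldepth-∘C : ∀ A B → ldepth (A ∘C B) ≡ ldepth A + ldepth B
ldepth-∘C hole       B = refl
ldepth-∘C (lamC A)   B = cong suc (ldepth-∘C A B)
ldepth-∘C (appL A _) B = ldepth-∘C A B
ldepth-∘C (appR _ A) B = ldepth-∘C A B
ldepth-∘C (esC A _)  B = ldepth-∘C A B

+-ldepth-∘C : ∀ m A B → m + ldepth (A ∘C B) ≡ m + ldepth B + ldepth A
+-ldepth-∘C m A B = begin
  m + ldepth (A ∘C B)       ≡⟨ cong (m +_) (ldepth-∘C A B) ⟩
  m + (ldepth A + ldepth B) ≡⟨ cong (m +_) (+-comm (ldepth A) (ldepth B)) ⟩
  m + (ldepth B + ldepth A) ≡⟨ +-assoc m (ldepth B) (ldepth A) ⟨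
  m + ldepth B + ldepth A   ∎

ldepth-toCtx : ∀ L → ldepth (toCtx L) ≡ 0
ldepth-toCtx []      = refl
ldepth-toCtx (_ ∷ L) = ldepth-toCtx L

∘L-identityʳ : ∀ C → C ∘L lhole ≡ C
∘L-identityʳ lhole       = refl
∘L-identityʳ (llamC C)   = cong llamC (∘L-identityʳ C)
∘L-identityʳ (lappL C a) = cong (λ D → lappL D a) (∘L-identityʳ C)
∘L-identityʳ (lappR a C) = cong (lappR a) (∘L-identityʳ C)

∘L-assoc : ∀ A B C → (A ∘L B) ∘L C ≡ A ∘L (B ∘L C)
∘L-assoc lhole       B C = refl
∘L-assoc (llamC A)   B C = cong llamC (∘L-assoc A B C)
∘L-assoc (lappL A a) B C = cong (λ D → lappL D a) (∘L-assoc A B C)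
∘L-assoc (lappR a A) B C = cong (lappR a) (∘L-assoc A B C)

lplug-∘L : ∀ A B a → lplug (A ∘L B) a ≡ lplug A (lplug B a)
lplug-∘L lhole       B a = refl
lplug-∘L (llamC A)   B a = cong llam (lplug-∘L A B a)
lplug-∘L (lappL A b) B a = cong (λ c → lapp c b) (lplug-∘L A B a)
lplug-∘L (lappR b A) B a = cong (lapp b) (lplug-∘L A B a)

lplug-injective : ∀ C {a b} → lplug C a ≡ lplug C b → a ≡ b
lplug-injective lhole       e = e
lplug-injective (llamC C)   e = lplug-injective C (llam-injective e)
lplug-injective (lappL C _) e = lplug-injective C (lapp-injectiveˡ e)
lplug-injective (lappR _ C) e = lplug-injective C (lapp-injectiveʳ e)

∘L-nonempty : ∀ A B → A ≢ lhole → A ∘L B ≢ lhole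
∘L-nonempty lhole       B A≢□ _ = A≢□ refl
∘L-nonempty (llamC _)   B _ ()
∘L-nonempty (lappL _ _) B _ ()
∘L-nonempty (lappR _ _) B _ ()

-- Relative unfolding

-- esSubst C m applies the explicit substitutions of C to a term lying under m further λs,
-- so that t ↓[ C ] ≡ esSubst C 0 (t ↓).
esSubst : Ctx → ℕ → Λ → Λ
esSubst hole       m a = a
esSubst (lamC C)   m a = esSubst C m a
esSubst (appL C _) m a = esSubst C m a
esSubst (appR _ C) m a = esSubst C m a
esSubst (esC C u)  m a = subΛ (m + ldepth C) (shiftΛ (m + ldepth C) 0 (u ↓)) (esSubst C m a)

↓[]-esSubst : ∀ t C → t ↓[ C ] ≡ esSubst C 0 (t ↓)
↓[]-esSubst t hole       = refl
↓[]-esSubst t (lamC C)   = ↓[]-esSubst t C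
↓[]-esSubst t (appL C _) = ↓[]-esSubst t C
↓[]-esSubst t (appR _ C) = ↓[]-esSubst t C
↓[]-esSubst t (esC C u)  = cong (subΛ (ldepth C) (shiftΛ (ldepth C) 0 (u ↓))) (↓[]-esSubst t C)

esSubst-∘C : ∀ A B m a → esSubst (A ∘C B) m a ≡ esSubst A (m + ldepth B) (esSubst B m a)
esSubst-∘C hole       B m a = refl
esSubst-∘C (lamC A)   B m a = esSubst-∘C A B m a
esSubst-∘C (appL A _) B m a = esSubst-∘C A B m a
esSubst-∘C (appR _ A) B m a = esSubst-∘C A B m a
esSubst-∘C (esC A u)  B m a =
  cong₂ (λ k → subΛ k (shiftΛ k 0 (u ↓))) (+-ldepth-∘C m A B) (esSubst-∘C A B m a)

↓[]-∘C : ∀ t A B → t ↓[ A ∘C B ] ≡ esSubst A (ldepth B) (t ↓[ B ])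
↓[]-∘C t A B = begin
  t ↓[ A ∘C B ]
    ≡⟨ ↓[]-esSubst t (A ∘C B) ⟩
  esSubst (A ∘C B) 0 (t ↓)
    ≡⟨ esSubst-∘C A B 0 (t ↓) ⟩
  esSubst A (ldepth B) (esSubst B 0 (t ↓))
    ≡⟨ cong (esSubst A (ldepth B)) (↓[]-esSubst t B) ⟨
  esSubst A (ldepth B) (t ↓[ B ]) ∎

esSubst-llam : ∀ C m a → esSubst C m (llam a) ≡ llam (esSubst C (suc m) a)
esSubst-llam hole       m a = refl
esSubst-llam (lamC C)   m a = esSubst-llam C m a
esSubst-llam (appL C _) m a = esSubst-llam C m a
esSubst-llam (appR _ C) m a = esSubst-llam C m a
esSubst-llam (esC C u)  m a =
  trans (cong (subΛ _ _) (esSubst-llam C m a))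
        (cong (λ v → llam (subΛ (suc (m + ldepth C)) v (esSubst C (suc m) a)))
              (shiftΛ-shiftΛ 1 (m + ldepth C) 0 0 (u ↓) z≤n z≤n))

esSubst-lapp : ∀ C m a b → esSubst C m (lapp a b) ≡ lapp (esSubst C m a) (esSubst C m b)
esSubst-lapp hole       m a b = refl
esSubst-lapp (lamC C)   m a b = esSubst-lapp C m a b
esSubst-lapp (appL C _) m a b = esSubst-lapp C m a b
esSubst-lapp (appR _ C) m a b = esSubst-lapp C m a b
esSubst-lapp (esC C u)  m a b = cong (subΛ _ _) (esSubst-lapp C m a b)

esSubst-subΛ : ∀ C m v a → esSubst C m (subΛ m v a) ≡ subΛ m (esSubst C m v) (esSubst C (suc m) a)
esSubst-subΛ hole       m v a = refl
esSubst-subΛ (lamC C)   m v a = esSubst-subΛ C m v a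
esSubst-subΛ (appL C _) m v a = esSubst-subΛ C m v a
esSubst-subΛ (appR _ C) m v a = esSubst-subΛ C m v a
esSubst-subΛ (esC C u)  m v a = begin
  subΛ k U (esSubst C m (subΛ m v a))
    ≡⟨ cong (subΛ k U) (esSubst-subΛ C m v a) ⟩
  subΛ k U (subΛ m (esSubst C m v) (esSubst C (suc m) a))
    ≡⟨ subΛ-subΛ m (ldepth C) U (esSubst C m v) (esSubst C (suc m) a) ⟩
  subΛ m (subΛ k U (esSubst C m v)) (subΛ (suc k) (shiftΛ 1 m U) (esSubst C (suc m) a))
    ≡⟨ cong (λ U′ → subΛ m (subΛ k U (esSubst C m v)) (subΛ (suc k) U′ (esSubst C (suc m) a)))
            (shiftΛ-shiftΛ 1 k 0 m (u ↓) z≤n (m≤m+n m (ldepth C))) ⟩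
  subΛ m (subΛ k U (esSubst C m v)) (subΛ (suc k) (shiftΛ (suc k) 0 (u ↓)) (esSubst C (suc m) a)) ∎
  where
  k = m + ldepth C
  U = shiftΛ k 0 (u ↓)

esSubst-shiftΛ : ∀ C n a → esSubst C 0 (shiftΛ (depth C + n) 0 a) ≡ shiftΛ (ldepth C + n) 0 a
esSubst-shiftΛ hole       n a = refl
esSubst-shiftΛ (lamC C)   n a = begin
  esSubst C 0 (shiftΛ (suc (depth C + n)) 0 a)
    ≡⟨ cong (λ d → esSubst C 0 (shiftΛ d 0 a)) (+-suc (depth C) n) ⟨
  esSubst C 0 (shiftΛ (depth C + suc n) 0 a)
    ≡⟨ esSubst-shiftΛ C (suc n) a ⟩
  shiftΛ (ldepth C + suc n) 0 a
    ≡⟨ cong (λ d → shiftΛ d 0 a) (+-suc (ldepth C) n) ⟩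
  shiftΛ (suc (ldepth C + n)) 0 a ∎
esSubst-shiftΛ (appL C _) n a = esSubst-shiftΛ C n a
esSubst-shiftΛ (appR _ C) n a = esSubst-shiftΛ C n a
esSubst-shiftΛ (esC C u)  n a = begin
  subΛ k U (esSubst C 0 (shiftΛ (suc (depth C + n)) 0 a))
    ≡⟨ cong (λ d → subΛ k U (esSubst C 0 (shiftΛ d 0 a))) (+-suc (depth C) n) ⟨
  subΛ k U (esSubst C 0 (shiftΛ (depth C + suc n) 0 a))
    ≡⟨ cong (subΛ k U) (esSubst-shiftΛ C (suc n) a) ⟩
  subΛ k U (shiftΛ (k + suc n) 0 a)
    ≡⟨ cong (λ d → subΛ k U (shiftΛ d 0 a)) (+-suc k n) ⟩
  subΛ k U (shiftΛ (suc (k + n)) 0 a)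
    ≡⟨ subΛ-shiftΛ (k + n) 0 k U a z≤n (m≤m+n k n) ⟩
  shiftΛ (k + n) 0 a ∎
  where
  k = ldepth C
  U = shiftΛ k 0 (u ↓)

↓[]-lam : ∀ t C → lam t ↓[ C ] ≡ llam (t ↓[ C ∘C lamC hole ])
↓[]-lam t C = begin
  lam t ↓[ C ]
    ≡⟨ ↓[]-esSubst (lam t) C ⟩
  esSubst C 0 (llam (t ↓))
    ≡⟨ esSubst-llam C 0 (t ↓) ⟩
  llam (esSubst C 1 (t ↓))
    ≡⟨ cong llam (↓[]-∘C t C (lamC hole)) ⟨
  llam (t ↓[ C ∘C lamC hole ]) ∎

↓[]-app : ∀ t u C → app t u ↓[ C ] ≡ lapp (t ↓[ C ]) (u ↓[ C ])
↓[]-app t u C = begin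
  app t u ↓[ C ]
    ≡⟨ ↓[]-esSubst (app t u) C ⟩
  esSubst C 0 (lapp (t ↓) (u ↓))
    ≡⟨ esSubst-lapp C 0 (t ↓) (u ↓) ⟩
  lapp (esSubst C 0 (t ↓)) (esSubst C 0 (u ↓))
    ≡⟨ cong₂ lapp (↓[]-esSubst t C) (↓[]-esSubst u C) ⟨
  lapp (t ↓[ C ]) (u ↓[ C ]) ∎

↓[]-es : ∀ t u C → es t u ↓[ C ] ≡ t ↓[ C ∘C esC hole u ]
↓[]-es t u C = begin
  es t u ↓[ C ]
    ≡⟨ ↓[]-esSubst (es t u) C ⟩
  esSubst C 0 (subΛ 0 (u ↓) (t ↓))
    ≡⟨ cong (λ v → esSubst C 0 (subΛ 0 v (t ↓))) (shiftΛ-zero 0 (u ↓)) ⟨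
  esSubst C 0 (subΛ 0 (shiftΛ 0 0 (u ↓)) (t ↓))
    ≡⟨ ↓[]-∘C t C (esC hole u) ⟨
  t ↓[ C ∘C esC hole u ] ∎

↓[]-appL : ∀ t C w → t ↓[ C ∘C appL hole w ] ≡ t ↓[ C ]
↓[]-appL t C w = trans (↓[]-∘C t C (appL hole w)) (sym (↓[]-esSubst t C))

↓[]-appR : ∀ t C w → t ↓[ C ∘C appR w hole ] ≡ t ↓[ C ]
↓[]-appR t C w = trans (↓[]-∘C t C (appR w hole)) (sym (↓[]-esSubst t C))

infix 25 _↓C[_]

_↓C[_] : Ctx → Ctx → LCtx
hole     ↓C[ C₀ ] = lhole
lamC C   ↓C[ C₀ ] = llamC (C ↓C[ C₀ ∘C lamC hole ])
appL C w ↓C[ C₀ ] = lappL (C ↓C[ C₀ ∘C appL hole w ]) (w ↓[ C₀ ])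
appR w C ↓C[ C₀ ] = lappR (w ↓[ C₀ ]) (C ↓C[ C₀ ∘C appR w hole ])
esC C u  ↓C[ C₀ ] = C ↓C[ C₀ ∘C esC hole u ]

esSubstC : Ctx → ℕ → LCtx → LCtx
esSubstC hole       m P = P
esSubstC (lamC C)   m P = esSubstC C m P
esSubstC (appL C _) m P = esSubstC C m P
esSubstC (appR _ C) m P = esSubstC C m P
esSubstC (esC C u)  m P = subC (m + ldepth C) (shiftΛ (m + ldepth C) 0 (u ↓)) (esSubstC C m P)

esSubstC-∘C : ∀ A B m P → esSubstC (A ∘C B) m P ≡ esSubstC A (m + ldepth B) (esSubstC B m P)
esSubstC-∘C hole       B m P = refl
esSubstC-∘C (lamC A)   B m P = esSubstC-∘C A B m P
esSubstC-∘C (appL A _) B m P = esSubstC-∘C A B m P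
esSubstC-∘C (appR _ A) B m P = esSubstC-∘C A B m P
esSubstC-∘C (esC A u)  B m P =
  cong₂ (λ k → subC k (shiftΛ k 0 (u ↓))) (+-ldepth-∘C m A B) (esSubstC-∘C A B m P)

esSubstC-lhole : ∀ C m → esSubstC C m lhole ≡ lhole
esSubstC-lhole hole       m = refl
esSubstC-lhole (lamC C)   m = esSubstC-lhole C m
esSubstC-lhole (appL C _) m = esSubstC-lhole C m
esSubstC-lhole (appR _ C) m = esSubstC-lhole C m
esSubstC-lhole (esC C u)  m = cong (subC _ _) (esSubstC-lhole C m)

esSubstC-llamC : ∀ C m P → esSubstC C m (llamC P) ≡ llamC (esSubstC C (suc m) P)
esSubstC-llamC hole       m P = refl
esSubstC-llamC (lamC C)   m P = esSubstC-llamC C m P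
esSubstC-llamC (appL C _) m P = esSubstC-llamC C m P
esSubstC-llamC (appR _ C) m P = esSubstC-llamC C m P
esSubstC-llamC (esC C u)  m P =
  trans (cong (subC _ _) (esSubstC-llamC C m P))
        (cong (λ v → llamC (subC (suc (m + ldepth C)) v (esSubstC C (suc m) P)))
              (shiftΛ-shiftΛ 1 (m + ldepth C) 0 0 (u ↓) z≤n z≤n))

esSubstC-lappL : ∀ C m P b → esSubstC C m (lappL P b) ≡ lappL (esSubstC C m P) (esSubst C m b)
esSubstC-lappL hole       m P b = refl
esSubstC-lappL (lamC C)   m P b = esSubstC-lappL C m P b
esSubstC-lappL (appL C _) m P b = esSubstC-lappL C m P b
esSubstC-lappL (appR _ C) m P b = esSubstC-lappL C m P b
esSubstC-lappL (esC C u)  m P b = cong (subC _ _) (esSubstC-lappL C m P b)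

esSubstC-lappR : ∀ C m P b → esSubstC C m (lappR b P) ≡ lappR (esSubst C m b) (esSubstC C m P)
esSubstC-lappR hole       m P b = refl
esSubstC-lappR (lamC C)   m P b = esSubstC-lappR C m P b
esSubstC-lappR (appL C _) m P b = esSubstC-lappR C m P b
esSubstC-lappR (appR _ C) m P b = esSubstC-lappR C m P b
esSubstC-lappR (esC C u)  m P b = cong (subC _ _) (esSubstC-lappR C m P b)

↓C[]-esSubstC : ∀ C C₀ → C ↓C[ C₀ ] ≡ esSubstC C₀ 0 (C ↓C)
↓C[]-esSubstC hole C₀ = sym (esSubstC-lhole C₀ 0)
↓C[]-esSubstC (lamC C) C₀ = begin
  llamC (C ↓C[ C₀ ∘C lamC hole ])
    ≡⟨ cong llamC (↓C[]-esSubstC C (C₀ ∘C lamC hole)) ⟩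
  llamC (esSubstC (C₀ ∘C lamC hole) 0 (C ↓C))
    ≡⟨ cong llamC (esSubstC-∘C C₀ (lamC hole) 0 (C ↓C)) ⟩
  llamC (esSubstC C₀ 1 (C ↓C))
    ≡⟨ esSubstC-llamC C₀ 0 (C ↓C) ⟨
  esSubstC C₀ 0 (llamC (C ↓C)) ∎
↓C[]-esSubstC (appL C w) C₀ = begin
  lappL (C ↓C[ C₀ ∘C appL hole w ]) (w ↓[ C₀ ])
    ≡⟨ cong₂ lappL (↓C[]-esSubstC C (C₀ ∘C appL hole w)) (↓[]-esSubst w C₀) ⟩
  lappL (esSubstC (C₀ ∘C appL hole w) 0 (C ↓C)) (esSubst C₀ 0 (w ↓))
    ≡⟨ cong (λ P → lappL P (esSubst C₀ 0 (w ↓))) (esSubstC-∘C C₀ (appL hole w) 0 (C ↓C)) ⟩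
  lappL (esSubstC C₀ 0 (C ↓C)) (esSubst C₀ 0 (w ↓))
    ≡⟨ esSubstC-lappL C₀ 0 (C ↓C) (w ↓) ⟨
  esSubstC C₀ 0 (lappL (C ↓C) (w ↓)) ∎
↓C[]-esSubstC (appR w C) C₀ = begin
  lappR (w ↓[ C₀ ]) (C ↓C[ C₀ ∘C appR w hole ])
    ≡⟨ cong₂ lappR (↓[]-esSubst w C₀) (↓C[]-esSubstC C (C₀ ∘C appR w hole)) ⟩
  lappR (esSubst C₀ 0 (w ↓)) (esSubstC (C₀ ∘C appR w hole) 0 (C ↓C))
    ≡⟨ cong (lappR (esSubst C₀ 0 (w ↓))) (esSubstC-∘C C₀ (appR w hole) 0 (C ↓C)) ⟩
  lappR (esSubst C₀ 0 (w ↓)) (esSubstC C₀ 0 (C ↓C))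
    ≡⟨ esSubstC-lappR C₀ 0 (C ↓C) (w ↓) ⟨
  esSubstC C₀ 0 (lappR (w ↓) (C ↓C)) ∎
↓C[]-esSubstC (esC C u) C₀ = begin
  C ↓C[ C₀ ∘C esC hole u ]
    ≡⟨ ↓C[]-esSubstC C (C₀ ∘C esC hole u) ⟩
  esSubstC (C₀ ∘C esC hole u) 0 (C ↓C)
    ≡⟨ esSubstC-∘C C₀ (esC hole u) 0 (C ↓C) ⟩
  esSubstC C₀ 0 (subC 0 (shiftΛ 0 0 (u ↓)) (C ↓C))
    ≡⟨ cong (λ v → esSubstC C₀ 0 (subC 0 v (C ↓C))) (shiftΛ-zero 0 (u ↓)) ⟩
  esSubstC C₀ 0 (subC 0 (u ↓) (C ↓C)) ∎

↓C[hole] : ∀ C → C ↓C[ hole ] ≡ C ↓C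
↓C[hole] C = ↓C[]-esSubstC C hole

plug-↓[] : ∀ C t C₀ → plug C t ↓[ C₀ ] ≡ lplug (C ↓C[ C₀ ]) (t ↓[ C₀ ∘C C ])
plug-↓[] hole t C₀ = cong (t ↓[_]) (sym (∘C-identityʳ C₀))
plug-↓[] (lamC C) t C₀ = begin
  lam (plug C t) ↓[ C₀ ]
    ≡⟨ ↓[]-lam (plug C t) C₀ ⟩
  llam (plug C t ↓[ C₁ ])
    ≡⟨ cong llam (plug-↓[] C t C₁) ⟩
  llam (lplug (C ↓C[ C₁ ]) (t ↓[ C₁ ∘C C ]))
    ≡⟨ cong (λ D → llam (lplug (C ↓C[ C₁ ]) (t ↓[ D ]))) (∘C-assoc C₀ (lamC hole) C) ⟩
  llam (lplug (C ↓C[ C₁ ]) (t ↓[ C₀ ∘C lamC C ])) ∎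
  where C₁ = C₀ ∘C lamC hole
plug-↓[] (appL C w) t C₀ = begin
  app (plug C t) w ↓[ C₀ ]
    ≡⟨ ↓[]-app (plug C t) w C₀ ⟩
  lapp (plug C t ↓[ C₀ ]) (w ↓[ C₀ ])
    ≡⟨ cong (λ a → lapp a (w ↓[ C₀ ])) (↓[]-appL (plug C t) C₀ w) ⟨
  lapp (plug C t ↓[ C₁ ]) (w ↓[ C₀ ])
    ≡⟨ cong (λ a → lapp a (w ↓[ C₀ ])) (plug-↓[] C t C₁) ⟩
  lapp (lplug (C ↓C[ C₁ ]) (t ↓[ C₁ ∘C C ])) (w ↓[ C₀ ])
    ≡⟨ cong (λ D → lapp (lplug (C ↓C[ C₁ ]) (t ↓[ D ])) (w ↓[ C₀ ])) (∘C-assoc C₀ (appL hole w) C) ⟩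
  lapp (lplug (C ↓C[ C₁ ]) (t ↓[ C₀ ∘C appL C w ])) (w ↓[ C₀ ]) ∎
  where C₁ = C₀ ∘C appL hole w
plug-↓[] (appR w C) t C₀ = begin
  app w (plug C t) ↓[ C₀ ]
    ≡⟨ ↓[]-app w (plug C t) C₀ ⟩
  lapp (w ↓[ C₀ ]) (plug C t ↓[ C₀ ])
    ≡⟨ cong (lapp (w ↓[ C₀ ])) (↓[]-appR (plug C t) C₀ w) ⟨
  lapp (w ↓[ C₀ ]) (plug C t ↓[ C₁ ])
    ≡⟨ cong (lapp (w ↓[ C₀ ])) (plug-↓[] C t C₁) ⟩
  lapp (w ↓[ C₀ ]) (lplug (C ↓C[ C₁ ]) (t ↓[ C₁ ∘C C ]))
    ≡⟨ cong (λ D → lapp (w ↓[ C₀ ]) (lplug (C ↓C[ C₁ ]) (t ↓[ D ]))) (∘C-assoc C₀ (appR w hole) C) ⟩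
  lapp (w ↓[ C₀ ]) (lplug (C ↓C[ C₁ ]) (t ↓[ C₀ ∘C appR w C ])) ∎
  where C₁ = C₀ ∘C appR w hole
plug-↓[] (esC C u) t C₀ = begin
  es (plug C t) u ↓[ C₀ ]
    ≡⟨ ↓[]-es (plug C t) u C₀ ⟩
  plug C t ↓[ C₁ ]
    ≡⟨ plug-↓[] C t C₁ ⟩
  lplug (C ↓C[ C₁ ]) (t ↓[ C₁ ∘C C ])
    ≡⟨ cong (λ D → lplug (C ↓C[ C₁ ]) (t ↓[ D ])) (∘C-assoc C₀ (esC hole u) C) ⟩
  lplug (C ↓C[ C₁ ]) (t ↓[ C₀ ∘C esC C u ]) ∎
  where C₁ = C₀ ∘C esC hole u

↓C[]-∘C : ∀ A B C₀ → (A ∘C B) ↓C[ C₀ ] ≡ A ↓C[ C₀ ] ∘L B ↓C[ C₀ ∘C A ]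
↓C[]-∘C hole B C₀ = cong (B ↓C[_]) (sym (∘C-identityʳ C₀))
↓C[]-∘C (lamC A) B C₀ =
  cong llamC (trans (↓C[]-∘C A B C₁) (cong (λ D → A ↓C[ C₁ ] ∘L B ↓C[ D ]) (∘C-assoc C₀ (lamC hole) A)))
  where C₁ = C₀ ∘C lamC hole
↓C[]-∘C (appL A w) B C₀ =
  cong (λ P → lappL P (w ↓[ C₀ ]))
       (trans (↓C[]-∘C A B C₁) (cong (λ D → A ↓C[ C₁ ] ∘L B ↓C[ D ]) (∘C-assoc C₀ (appL hole w) A)))
  where C₁ = C₀ ∘C appL hole w
↓C[]-∘C (appR w A) B C₀ =
  cong (lappR (w ↓[ C₀ ]))
       (trans (↓C[]-∘C A B C₁) (cong (λ D → A ↓C[ C₁ ] ∘L B ↓C[ D ]) (∘C-assoc C₀ (appR w hole) A)))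
  where C₁ = C₀ ∘C appR w hole
↓C[]-∘C (esC A u) B C₀ =
  trans (↓C[]-∘C A B C₁) (cong (λ D → A ↓C[ C₁ ] ∘L B ↓C[ D ]) (∘C-assoc C₀ (esC hole u) A))
  where C₁ = C₀ ∘C esC hole u

plug-↓ : ∀ C r → plug C r ↓ ≡ lplug (C ↓C) (r ↓[ C ])
plug-↓ C r = trans (plug-↓[] C r hole) (cong (λ D → lplug D (r ↓[ C ])) (↓C[hole] C))

plug-toCtx-↓[] : ∀ L t C → plug (toCtx L) t ↓[ C ] ≡ t ↓[ C ∘C toCtx L ]
plug-toCtx-↓[] []      t C = cong (t ↓[_]) (sym (∘C-identityʳ C))
plug-toCtx-↓[] (u ∷ L) t C = begin
  es (plug (toCtx L) t) u ↓[ C ]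
    ≡⟨ ↓[]-es (plug (toCtx L) t) u C ⟩
  plug (toCtx L) t ↓[ C ∘C esC hole u ]
    ≡⟨ plug-toCtx-↓[] L t (C ∘C esC hole u) ⟩
  t ↓[ (C ∘C esC hole u) ∘C toCtx L ]
    ≡⟨ cong (t ↓[_]) (∘C-assoc C (esC hole u) (toCtx L)) ⟩
  t ↓[ C ∘C esC (toCtx L) u ] ∎

-- Projection

depth-toCtx : ∀ L → depth (toCtx L) ≡ length L
depth-toCtx []      = refl
depth-toCtx (_ ∷ L) = cong suc (depth-toCtx L)

shiftT-length-↓[toCtx] : ∀ L q → shiftT (length L) 0 q ↓[ toCtx L ] ≡ q ↓
shiftT-length-↓[toCtx] L q = begin
  shiftT (length L) 0 q ↓[ toCtx L ]
    ≡⟨ ↓[]-esSubst (shiftT (length L) 0 q) (toCtx L) ⟩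
  esSubst (toCtx L) 0 (shiftT (length L) 0 q ↓)
    ≡⟨ cong (esSubst (toCtx L) 0) (↓-shiftT (length L) 0 q) ⟩
  esSubst (toCtx L) 0 (shiftΛ (length L) 0 (q ↓))
    ≡⟨ cong (λ d → esSubst (toCtx L) 0 (shiftΛ d 0 (q ↓))) (trans (+-identityʳ _) (depth-toCtx L)) ⟨
  esSubst (toCtx L) 0 (shiftΛ (depth (toCtx L) + 0) 0 (q ↓))
    ≡⟨ esSubst-shiftΛ (toCtx L) 0 (q ↓) ⟩
  shiftΛ (ldepth (toCtx L) + 0) 0 (q ↓)
    ≡⟨ cong (λ d → shiftΛ (d + 0) 0 (q ↓)) (ldepth-toCtx L) ⟩
  shiftΛ 0 0 (q ↓)
    ≡⟨ shiftΛ-zero 0 (q ↓) ⟩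
  q ↓ ∎

shiftT-length-↓[∘toCtx] : ∀ C L q → shiftT (length L) 0 q ↓[ C ∘C toCtx L ] ≡ q ↓[ C ]
shiftT-length-↓[∘toCtx] C L q = begin
  q′ ↓[ C ∘C toCtx L ]
    ≡⟨ ↓[]-∘C q′ C (toCtx L) ⟩
  esSubst C (ldepth (toCtx L)) (q′ ↓[ toCtx L ])
    ≡⟨ cong₂ (esSubst C) (ldepth-toCtx L) (shiftT-length-↓[toCtx] L q) ⟩
  esSubst C 0 (q ↓)
    ≡⟨ ↓[]-esSubst q C ⟨
  q ↓[ C ] ∎
  where q′ = shiftT (length L) 0 q

dBRedex-↓[] : ∀ C L s q → dBRedex L s q ↓[ C ] ≡ lapp (llam (s ↓[ (C ∘C toCtx L) ∘C lamC hole ])) (q ↓[ C ])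
dBRedex-↓[] C L s q = begin
  app (plug (toCtx L) (lam s)) q ↓[ C ]
    ≡⟨ ↓[]-app (plug (toCtx L) (lam s)) q C ⟩
  lapp (plug (toCtx L) (lam s) ↓[ C ]) (q ↓[ C ])
    ≡⟨ cong (λ a → lapp a (q ↓[ C ])) (plug-toCtx-↓[] L (lam s) C) ⟩
  lapp (lam s ↓[ C ∘C toCtx L ]) (q ↓[ C ])
    ≡⟨ cong (λ a → lapp a (q ↓[ C ])) (↓[]-lam s (C ∘C toCtx L)) ⟩
  lapp (llam (s ↓[ (C ∘C toCtx L) ∘C lamC hole ])) (q ↓[ C ]) ∎

dBContractum-↓[] : ∀ C L s q → dBContractum L s q ↓[ C ] ≡ subΛ 0 (q ↓[ C ]) (s ↓[ (C ∘C toCtx L) ∘C lamC hole ])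
dBContractum-↓[] C L s q = begin
  plug (toCtx L) (es s q′) ↓[ C ]
    ≡⟨ plug-toCtx-↓[] L (es s q′) C ⟩
  es s q′ ↓[ X ]
    ≡⟨ ↓[]-esSubst (es s q′) X ⟩
  esSubst X 0 (subΛ 0 (q′ ↓) (s ↓))
    ≡⟨ esSubst-subΛ X 0 (q′ ↓) (s ↓) ⟩
  subΛ 0 (esSubst X 0 (q′ ↓)) (esSubst X 1 (s ↓))
    ≡⟨ cong₂ (subΛ 0) (↓[]-esSubst q′ X) (↓[]-∘C s X (lamC hole)) ⟨
  subΛ 0 (q′ ↓[ X ]) (s ↓[ X ∘C lamC hole ])
    ≡⟨ cong (λ a → subΛ 0 a (s ↓[ X ∘C lamC hole ])) (shiftT-length-↓[∘toCtx] C L q) ⟩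
  subΛ 0 (q ↓[ C ]) (s ↓[ X ∘C lamC hole ]) ∎
  where
  q′ = shiftT (length L) 0 q
  X = C ∘C toCtx L

dB-↓[]-rootBeta : ∀ C L s q → RootBeta (dBRedex L s q ↓[ C ]) (dBContractum L s q ↓[ C ])
dB-↓[]-rootBeta C L s q = subst₂ RootBeta (sym (dBRedex-↓[] C L s q)) (sym (dBContractum-↓[] C L s q)) (β _ _)

-- β-redexes of the unfolding come from useful redexes

LsRedexAt-∘C : ∀ G {t C r} → LsRedexAt t C r → LsRedexAt (plug G t) (G ∘C C) r
LsRedexAt-∘C G (D , C′ , u , refl , refl , refl) =
  G ∘C D , C′ , u , sym (∘C-assoc G D (esC C′ u)) , sym (plug-∘C G (D ∘C esC C′ u) (var (depth C′))) , refl

shiftT-↓[esC] : ∀ C u → shiftT (suc (depth C)) 0 u ↓[ esC C u ] ≡ shiftΛ (ldepth C) 0 (u ↓)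
shiftT-↓[esC] C u = begin
  subΛ k U (shiftT (suc (depth C)) 0 u ↓[ C ])
    ≡⟨ cong (subΛ k U) (↓[]-esSubst (shiftT (suc (depth C)) 0 u) C) ⟩
  subΛ k U (esSubst C 0 (shiftT (suc (depth C)) 0 u ↓))
    ≡⟨ cong (λ a → subΛ k U (esSubst C 0 a)) (↓-shiftT (suc (depth C)) 0 u) ⟩
  subΛ k U (esSubst C 0 (shiftΛ (suc (depth C)) 0 (u ↓)))
    ≡⟨ cong (λ d → subΛ k U (esSubst C 0 (shiftΛ d 0 (u ↓)))) (+-comm (depth C) 1) ⟨
  subΛ k U (esSubst C 0 (shiftΛ (depth C + 1) 0 (u ↓)))
    ≡⟨ cong (subΛ k U) (esSubst-shiftΛ C 1 (u ↓)) ⟩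
  subΛ k U (shiftΛ (k + 1) 0 (u ↓))
    ≡⟨ cong (λ d → subΛ k U (shiftΛ d 0 (u ↓))) (+-comm k 1) ⟩
  subΛ k U (shiftΛ (suc k) 0 (u ↓))
    ≡⟨ subΛ-shiftΛ k 0 k U (u ↓) z≤n ≤-refl ⟩
  U ∎
  where
  k = ldepth C
  U = shiftΛ k 0 (u ↓)

data VarUnfolding (C : Ctx) (j : ℕ) : Set where
  bound       : ∀ i → var j ↓[ C ] ≡ lvar i → i < ldepth C → VarUnfolding C j
  free        : ∀ n → j ≡ depth C + n → var j ↓[ C ] ≡ lvar (ldepth C + n) → VarUnfolding C j
  substituted : ∀ r → LsRedexAt (plug C (var j)) C r → r ↓[ C ] ≡ var j ↓[ C ] → VarUnfolding C j

varUnfolding : ∀ C j → VarUnfolding C j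
varUnfolding hole j = free j refl refl
varUnfolding (lamC C) j with varUnfolding C j
... | bound i e i<k        = bound i e (m<n⇒m<1+n i<k)
... | free zero _ e        = bound (ldepth C) (trans e (cong lvar (+-identityʳ _))) ≤-refl
... | free (suc n) j≡ e    = free n (trans j≡ (+-suc _ n)) (trans e (cong lvar (+-suc _ n)))
... | substituted r lsAt e = substituted r (LsRedexAt-∘C (lamC hole) lsAt) e
varUnfolding (appL C w) j with varUnfolding C j
... | bound i e i<k        = bound i e i<k
... | free n j≡ e          = free n j≡ e
... | substituted r lsAt e = substituted r (LsRedexAt-∘C (appL hole w) lsAt) e
varUnfolding (appR w C) j with varUnfolding C j
... | bound i e i<k        = bound i e i<k
... | free n j≡ e          = free n j≡ e
... | substituted r lsAt e = substituted r (LsRedexAt-∘C (appR w hole) lsAt) e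
varUnfolding (esC C u) j with varUnfolding C j
... | bound i e i<k        = bound i (trans (cong (subΛ _ _) e) (subΛ-var< _ i<k)) i<k
... | free (suc n) j≡ e    =
  free n (trans j≡ (+-suc _ n))
         (trans (cong (subΛ _ _) (trans e (cong lvar (+-suc _ n)))) (subΛ-var> _ (s≤s (m≤m+n _ n))))
... | substituted r lsAt e = substituted r (LsRedexAt-∘C (esC hole u) lsAt) (cong (subΛ _ _) e)
... | free zero j≡ e       =
  substituted (shiftT (suc (depth C)) 0 u) (hole , C , u , refl , cong (λ i → es (plug C (var i)) u) j≡0 , refl)
    (trans (shiftT-↓[esC] C u) (sym (trans (cong (subΛ k U) e′) (subΛ-var≡ k U))))
  where
  k = ldepth C
  U = shiftΛ k 0 (u ↓)
  j≡0 = trans j≡ (+-identityʳ _)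
  e′ = trans e (cong lvar (+-identityʳ k))

BetaRedexAt-resp : ∀ {a b D} → a ≡ b → BetaRedexAt a D → BetaRedexAt b D
BetaRedexAt-resp refl red = red

¬BetaRedexAt-lvar : ∀ {i D} → ¬ BetaRedexAt (lvar i) D
¬BetaRedexAt-lvar {D = lhole}     (_ , _ , ())
¬BetaRedexAt-lvar {D = llamC _}   (_ , _ , ())
¬BetaRedexAt-lvar {D = lappL _ _} (_ , _ , ())
¬BetaRedexAt-lvar {D = lappR _ _} (_ , _ , ())

BetaRedexAt-llam : ∀ {a D} → BetaRedexAt (llam a) D → Σ LCtx λ D₁ → D ≡ llamC D₁ × BetaRedexAt a D₁
BetaRedexAt-llam {D = lhole}     (_ , _ , ())
BetaRedexAt-llam {D = llamC D}   (b , c , e) = D , refl , b , c , llam-injective e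
BetaRedexAt-llam {D = lappL _ _} (_ , _ , ())
BetaRedexAt-llam {D = lappR _ _} (_ , _ , ())

data BetaRedexInLapp (a b : Λ) : LCtx → Set where
  atRoot : IsAbs a → BetaRedexInLapp a b lhole
  inFun  : ∀ {D} → BetaRedexAt a D → BetaRedexInLapp a b (lappL D b)
  inArg  : ∀ {D} → BetaRedexAt b D → BetaRedexInLapp a b (lappR a D)

betaRedexInLapp : ∀ {a b D} → BetaRedexAt (lapp a b) D → BetaRedexInLapp a b D
betaRedexInLapp {D = lhole}     (b′ , _ , e) = atRoot (b′ , lapp-injectiveˡ e)
betaRedexInLapp {D = llamC _}   (_ , _ , ())
betaRedexInLapp {D = lappL D _} (b′ , c′ , e) rewrite lapp-injectiveʳ e = inFun (b′ , c′ , lapp-injectiveˡ e)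
betaRedexInLapp {D = lappR _ D} (b′ , c′ , e) rewrite lapp-injectiveˡ e = inArg (b′ , c′ , lapp-injectiveʳ e)

data AbstractionSource (C₀ : Ctx) (t : Tm) : Set where
  abstraction    : ∀ L s → t ≡ plug (toCtx L) (lam s) → AbstractionSource C₀ t
  substitutedVar : ∀ L j r → t ≡ plug (toCtx L) (var j) → LsRedexAt (plug C₀ t) (C₀ ∘C toCtx L) r →
                   IsAbs (r ↓[ C₀ ∘C toCtx L ]) → AbstractionSource C₀ t

abstractionSource : ∀ t C₀ {b} → t ↓[ C₀ ] ≡ llam b → AbstractionSource C₀ t
abstractionSource (var j) C₀ {b} eq with varUnfolding C₀ j
... | bound i e _ with () ← trans (sym e) eq
... | free n _ e with () ← trans (sym e) eq
... | substituted r lsAt e =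
  substitutedVar [] j r refl (subst (λ C → LsRedexAt (plug C₀ (var j)) C r) C₀≡ lsAt)
                             (subst (λ C → IsAbs (r ↓[ C ])) C₀≡ (b , trans e eq))
  where C₀≡ = sym (∘C-identityʳ C₀)
abstractionSource (lam s) C₀ eq = abstraction [] s refl
abstractionSource (app t u) C₀ eq with () ← trans (sym (↓[]-app t u C₀)) eq
abstractionSource (es t u) C₀ eq with abstractionSource t (C₀ ∘C esC hole u) (trans (sym (↓[]-es t u C₀)) eq)
... | abstraction L s e = abstraction (u ∷ L) s (cong (λ t′ → es t′ u) e)
... | substitutedVar L j r e lsAt abs =
  substitutedVar (u ∷ L) j r (cong (λ t′ → es t′ u) e)
    (subst₂ (λ T C → LsRedexAt T C r) (plug-∘C C₀ (esC hole u) t) assoc lsAt)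
    (subst (λ C → IsAbs (r ↓[ C ])) assoc abs)
  where assoc = ∘C-assoc C₀ (esC hole u) (toCtx L)

-- A β-redex at D′ in t ↓[ C₀ ] arises from the useful redex at C₀⟨C′⟩ either inside the unfolding
-- of C′, or, when C′ is the head variable of D⟨L w⟩ and is substituted by an abstraction, at the
-- unfolding of D.
data Origin (C₀ : Ctx) (t : Tm) (C′ : Ctx) (D′ : LCtx) : Set where
  inside : ∀ F → D′ ≡ C′ ↓C[ C₀ ] ∘L F → Origin C₀ t C′ D′
  atHead : ∀ D L w j → C′ ≡ D ∘C appL (toCtx L) w → D′ ≡ D ↓C[ C₀ ] → t ≡ plug C′ (var j) →
           Origin C₀ t C′ D′

UsefulSource : Ctx → Tm → LCtx → Set
UsefulSource C₀ t D′ = Σ Ctx λ C′ → UsefulAt (plug C₀ t) (C₀ ∘C C′) × Origin C₀ t C′ D′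

usefulSource-plug : ∀ C₀ G t D₁ → UsefulSource (C₀ ∘C G) t D₁ →
                    UsefulSource C₀ (plug G t) (G ↓C[ C₀ ] ∘L D₁)
usefulSource-plug C₀ G t D₁ (C₁ , useful , origin) =
  G ∘C C₁ , subst₂ UsefulAt (plug-∘C C₀ G t) (∘C-assoc C₀ G C₁) useful , lift origin
  where
  lift : Origin (C₀ ∘C G) t C₁ D₁ → Origin C₀ (plug G t) (G ∘C C₁) (G ↓C[ C₀ ] ∘L D₁)
  lift (inside F e) = inside F (begin
    G ↓C[ C₀ ] ∘L D₁
      ≡⟨ cong (G ↓C[ C₀ ] ∘L_) e ⟩
    G ↓C[ C₀ ] ∘L (C₁ ↓C[ C₀ ∘C G ] ∘L F)
      ≡⟨ ∘L-assoc (G ↓C[ C₀ ]) (C₁ ↓C[ C₀ ∘C G ]) F ⟨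
    (G ↓C[ C₀ ] ∘L C₁ ↓C[ C₀ ∘C G ]) ∘L F
      ≡⟨ cong (_∘L F) (↓C[]-∘C G C₁ C₀) ⟨
    (G ∘C C₁) ↓C[ C₀ ] ∘L F ∎)
  lift (atHead D L w j eC eD et) =
    atHead (G ∘C D) L w j (trans (cong (G ∘C_) eC) (sym (∘C-assoc G D (appL (toCtx L) w))))
                          (trans (cong (G ↓C[ C₀ ] ∘L_) eD) (sym (↓C[]-∘C G D C₀)))
                          (trans (cong (plug G) et) (sym (plug-∘C G C₁ (var j))))

usefulSource : ∀ t C₀ D′ → BetaRedexAt (t ↓[ C₀ ]) D′ → UsefulSource C₀ t D′
usefulSource (var j) C₀ D′ red with varUnfolding C₀ j
... | bound i e _ = ⊥-elim (¬BetaRedexAt-lvar (BetaRedexAt-resp e red))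
... | free n _ e  = ⊥-elim (¬BetaRedexAt-lvar (BetaRedexAt-resp e red))
... | substituted r lsAt e =
  hole , subst (UsefulAt (plug C₀ (var j))) (sym (∘C-identityʳ C₀)) useful , inside D′ refl
  where useful = ls r lsAt (inj₁ (D′ , BetaRedexAt-resp (sym e) red))
usefulSource (lam t) C₀ D′ red with BetaRedexAt-llam (BetaRedexAt-resp (↓[]-lam t C₀) red)
... | D₁ , refl , red₁ = usefulSource-plug C₀ (lamC hole) t D₁ (usefulSource t (C₀ ∘C lamC hole) D₁ red₁)
usefulSource (app t₁ t₂) C₀ D′ red with betaRedexInLapp (BetaRedexAt-resp (↓[]-app t₁ t₂ C₀) red)
... | inFun {D₁} red₁ =
  usefulSource-plug C₀ (appL hole t₂) t₁ D₁
    (usefulSource t₁ (C₀ ∘C appL hole t₂) D₁ (BetaRedexAt-resp (sym (↓[]-appL t₁ C₀ t₂)) red₁))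
... | inArg {D₂} red₂ =
  usefulSource-plug C₀ (appR t₁ hole) t₂ D₂
    (usefulSource t₂ (C₀ ∘C appR t₁ hole) D₂ (BetaRedexAt-resp (sym (↓[]-appR t₂ C₀ t₁)) red₂))
... | atRoot (b , eb) with abstractionSource t₁ (C₀ ∘C appL hole t₂) (trans (↓[]-appL t₁ C₀ t₂) eb)
...   | abstraction L s e =
  hole , dB (L , s , t₂ , trans (cong (λ t → plug C₀ (app t t₂)) e) (cong (λ C → plug C (dBRedex L s t₂)) C₀≡)) ,
  inside lhole refl
  where C₀≡ = sym (∘C-identityʳ C₀)
...   | substitutedVar L j r e lsAt abs =
  appL (toCtx L) t₂ ,
  ls r (subst₂ (λ T C → LsRedexAt T C r) (plug-∘C C₀ (appL hole t₂) t₁) assoc lsAt)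
       (inj₂ (subst (λ C → IsAbs (r ↓[ C ])) assoc abs , C₀ , L , t₂ , refl)) ,
  atHead hole L t₂ j refl refl (cong (λ t → app t t₂) e)
  where assoc = ∘C-assoc C₀ (appL hole t₂) (toCtx L)
usefulSource (es t u) C₀ D′ red =
  usefulSource-plug C₀ (esC hole u) t D′
    (usefulSource t (C₀ ∘C esC hole u) D′ (BetaRedexAt-resp (↓[]-es t u C₀) red))

-- Transfer of the leftmost-outermost order

∘C-comparable : ∀ A G D H → A ∘C G ≡ D ∘C H →
  (Σ Ctx λ K → D ≡ A ∘C K × G ≡ K ∘C H) ⊎ (Σ Ctx λ K → A ≡ D ∘C K × H ≡ K ∘C G)
∘C-comparable hole       G D    H e = inj₁ (D , refl , e)
∘C-comparable (lamC A)   G hole H e = inj₂ (lamC A , refl , sym e)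
∘C-comparable (appL A t) G hole H e = inj₂ (appL A t , refl , sym e)
∘C-comparable (appR t A) G hole H e = inj₂ (appR t A , refl , sym e)
∘C-comparable (esC A t)  G hole H e = inj₂ (esC A t , refl , sym e)
∘C-comparable (lamC A) G (lamC D) H e with ∘C-comparable A G D H (lamC-injective e)
... | inj₁ (K , e₁ , e₂) = inj₁ (K , cong lamC e₁ , e₂)
... | inj₂ (K , e₁ , e₂) = inj₂ (K , cong lamC e₁ , e₂)
∘C-comparable (appL A t) G (appL D u) H e with appL-injective e
... | e′ , refl with ∘C-comparable A G D H e′
...   | inj₁ (K , e₁ , e₂) = inj₁ (K , cong (λ B → appL B t) e₁ , e₂)
...   | inj₂ (K , e₁ , e₂) = inj₂ (K , cong (λ B → appL B t) e₁ , e₂)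
∘C-comparable (appR t A) G (appR u D) H e with appR-injective e
... | refl , e′ with ∘C-comparable A G D H e′
...   | inj₁ (K , e₁ , e₂) = inj₁ (K , cong (appR t) e₁ , e₂)
...   | inj₂ (K , e₁ , e₂) = inj₂ (K , cong (appR t) e₁ , e₂)
∘C-comparable (esC A t) G (esC D u) H e with esC-injective e
... | e′ , refl with ∘C-comparable A G D H e′
...   | inj₁ (K , e₁ , e₂) = inj₁ (K , cong (λ B → esC B t) e₁ , e₂)
...   | inj₂ (K , e₁ , e₂) = inj₂ (K , cong (λ B → esC B t) e₁ , e₂)

∘C-toCtx-suffix : ∀ K X L → K ∘C X ≡ toCtx L → Σ SubCtx λ L′ → X ≡ toCtx L′
∘C-toCtx-suffix hole       X L       e = L , e
∘C-toCtx-suffix (esC K u)  X (_ ∷ L) e = ∘C-toCtx-suffix K X L (proj₁ (esC-injective e))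
∘C-toCtx-suffix (lamC _)   _ []      ()
∘C-toCtx-suffix (lamC _)   _ (_ ∷ _) ()
∘C-toCtx-suffix (appL _ _) _ []      ()
∘C-toCtx-suffix (appL _ _) _ (_ ∷ _) ()
∘C-toCtx-suffix (appR _ _) _ []      ()
∘C-toCtx-suffix (appR _ _) _ (_ ∷ _) ()
∘C-toCtx-suffix (esC _ _)  _ []      ()

plug-toCtx-lam≢var : ∀ L L′ s j → plug (toCtx L) (lam s) ≢ plug (toCtx L′) (var j)
plug-toCtx-lam≢var []      []       s j ()
plug-toCtx-lam≢var []      (_ ∷ _)  s j ()
plug-toCtx-lam≢var (_ ∷ _) []       s j ()
plug-toCtx-lam≢var (_ ∷ L) (_ ∷ L′) s j e = plug-toCtx-lam≢var L L′ s j (es-injectiveˡ e)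

app≢plug-toCtx-var : ∀ L a b j → app a b ≢ plug (toCtx L) (var j)
app≢plug-toCtx-var []      a b j ()
app≢plug-toCtx-var (_ ∷ _) a b j ()

dBRedex≢applied-var : ∀ L₀ s q L w j → dBRedex L₀ s q ≢ app (plug (toCtx L) (var j)) w
dBRedex≢applied-var L₀ s q L w j e = plug-toCtx-lam≢var L₀ L s j (app-injectiveˡ e)

app-position : ∀ {a b} G x C₀ → app a b ≡ plug G x → G ≡ hole ⊎ G ↓C[ C₀ ] ≢ lhole
app-position hole       _ _ _  = inj₁ refl
app-position (appL _ _) _ _ _  = inj₂ λ ()
app-position (appR _ _) _ _ _  = inj₂ λ ()
app-position (lamC _)   _ _ ()
app-position (esC _ _)  _ _ ()

appliedVar-below-dBRedex : ∀ C G D L w j L₀ s q → dBRedex L₀ s q ≡ plug G (var j) →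
                           C ∘C G ≡ D ∘C appL (toCtx L) w → Σ Ctx λ K → D ≡ C ∘C K × K ↓C[ C ] ≢ lhole
appliedVar-below-dBRedex C G D L w j L₀ s q e eC with ∘C-comparable C G D (appL (toCtx L) w) eC
... | inj₁ (K , refl , refl) with app-position K _ C (trans e (plug-∘C K (appL (toCtx L) w) (var j)))
...   | inj₁ refl = ⊥-elim (dBRedex≢applied-var L₀ s q L w j e)
...   | inj₂ K≢□  = K , refl , K≢□
appliedVar-below-dBRedex C G D L w j L₀ s q e eC | inj₂ (hole , _ , refl) =
  ⊥-elim (dBRedex≢applied-var L₀ s q L w j e)
appliedVar-below-dBRedex C G D L w j L₀ s q e eC | inj₂ (appL K _ , _ , eH)
  with ∘C-toCtx-suffix K G L (sym (proj₁ (appL-injective eH)))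
... | L′ , refl = ⊥-elim (app≢plug-toCtx-var L′ _ _ j e)

appliedVar-right-of : ∀ E w D₁ D L w′ → E ∘C appR w D₁ ≡ D ∘C appL (toCtx L) w′ →
                      Σ Ctx λ K → D ≡ E ∘C appR w K
appliedVar-right-of E w D₁ D L w′ e with ∘C-comparable E (appR w D₁) D (appL (toCtx L) w′) e
... | inj₁ (appR _ K , refl , eG) with appR-injective eG
...   | refl , _ = K , refl
appliedVar-right-of E w D₁ D L w′ e | inj₂ (appL K _ , _ , eH)
  with ∘C-toCtx-suffix K (appR w D₁) L (sym (proj₁ (appL-injective eH)))
... | []    , ()
... | _ ∷ _ , ()

≡⊎≺OΛ-∘L : ∀ C F → C ∘L F ≡ C ⊎ C ≺OΛ (C ∘L F)
≡⊎≺OΛ-∘L C lhole       = inj₁ (∘L-identityʳ C)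
≡⊎≺OΛ-∘L C (llamC F)   = inj₂ (outer C (llamC F) λ ())
≡⊎≺OΛ-∘L C (lappL F a) = inj₂ (outer C (lappL F a) λ ())
≡⊎≺OΛ-∘L C (lappR a F) = inj₂ (outer C (lappR a F) λ ())

≺LΛ-branches : ∀ {a r r′} E X U W Y → a ≡ lplug (E ∘L lappL X U) r → a ≡ lplug (E ∘L lappR W Y) r′ →
               (E ∘L lappL X U) ≺LΛ (E ∘L lappR W Y)
≺LΛ-branches {a} {r} {r′} E X U W Y e e′ =
  left E X Y W U (r , sym (lapp-injectiveˡ branches)) (r′ , lapp-injectiveʳ branches)
  where
  branches : lapp (lplug X r) U ≡ lapp W (lplug Y r′)
  branches = lplug-injective E (begin
    lplug E (lapp (lplug X r) U)  ≡⟨ lplug-∘L E (lappL X U) r ⟨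
    lplug (E ∘L lappL X U) r      ≡⟨ trans (sym e) e′ ⟩
    lplug (E ∘L lappR W Y) r′     ≡⟨ lplug-∘L E (lappR W Y) r′ ⟩
    lplug E (lapp W (lplug Y r′)) ∎)

origin-at-dBRedex : ∀ {t C L s q D′} → t ≡ plug C (dBRedex L s q) → Origin hole t C D′ →
                    D′ ≡ C ↓C[ hole ] ⊎ C ↓C[ hole ] ≺OΛ D′
origin-at-dBRedex et (inside F refl) = ≡⊎≺OΛ-∘L _ F
origin-at-dBRedex {C = C} et (atHead D L w j _ _ e) with () ← plug-injective C (trans (sym et) e)

origin-below-dBRedex : ∀ {t C L s q G x D′} → t ≡ plug C (dBRedex L s q) → t ≡ plug (C ∘C G) x →
                       G ≢ hole → Origin hole t (C ∘C G) D′ → C ↓C[ hole ] ≺OΛ D′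
origin-below-dBRedex {C = C} {G = G} {x} et ex G≢□ (inside F refl)
  with app-position G x C (plug-injective C (trans (sym et) (trans ex (plug-∘C C G x))))
... | inj₁ G≡□  = ⊥-elim (G≢□ G≡□)
... | inj₂ G↓≢□ =
  subst (C ↓C[ hole ] ≺OΛ_) (sym (trans (cong (_∘L F) (↓C[]-∘C C G hole)) (∘L-assoc (C ↓C[ hole ]) (G ↓C[ C ]) F)))
        (outer (C ↓C[ hole ]) (G ↓C[ C ] ∘L F) (∘L-nonempty (G ↓C[ C ]) F G↓≢□))
origin-below-dBRedex {C = C} {L} {s} {q} {G} et _ _ (atHead D L′ w j eC refl e)
  with appliedVar-below-dBRedex C G D L′ w j L s q (plug-injective C (trans (sym et) (trans e (plug-∘C C G (var j))))) eC
... | K , refl , K↓≢□ = subst (C ↓C[ hole ] ≺OΛ_) (sym (↓C[]-∘C C K hole)) (outer (C ↓C[ hole ]) (K ↓C[ C ]) K↓≢□)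

origin-right-branch : ∀ {t E w D₁ D′} → Origin hole t (E ∘C appR w D₁) D′ →
                      Σ LCtx λ Y → D′ ≡ E ↓C[ hole ] ∘L lappR (w ↓[ E ]) Y
origin-right-branch {E = E} {w} {D₁} (inside F refl) =
  D₁ ↓C[ E ∘C appR w hole ] ∘L F ,
  trans (cong (_∘L F) (↓C[]-∘C E (appR w D₁) hole)) (∘L-assoc (E ↓C[ hole ]) (appR w D₁ ↓C[ E ]) F)
origin-right-branch {E = E} {w} {D₁} (atHead D L w′ j eC refl _) with appliedVar-right-of E w D₁ D L w′ eC
... | K , refl = K ↓C[ E ∘C appR w hole ] , ↓C[]-∘C E (appR w K) hole

origin-right-of-position : ∀ {t E C₁ u w D₁ D′} R → t ≡ plug (E ∘C appL C₁ u) R → BetaRedexAt (t ↓) D′ →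
                           Origin hole t (E ∘C appR w D₁) D′ → (E ∘C appL C₁ u) ↓C[ hole ] ≺LΛ D′
origin-right-of-position {t} {E} {C₁} {u} {w} R et (_ , _ , eD′) origin with origin-right-branch origin
... | Y , refl =
  subst (_≺LΛ (E ↓C[ hole ] ∘L lappR (w ↓[ E ]) Y)) (sym C↓≡)
    (≺LΛ-branches (E ↓C[ hole ]) X (u ↓[ E ]) (w ↓[ E ]) Y t↓≡ eD′)
  where
  C = E ∘C appL C₁ u
  X = C₁ ↓C[ E ∘C appL hole u ]
  C↓≡ : C ↓C[ hole ] ≡ E ↓C[ hole ] ∘L lappL X (u ↓[ E ])
  C↓≡ = ↓C[]-∘C E (appL C₁ u) hole
  t↓≡ : t ↓ ≡ lplug (E ↓C[ hole ] ∘L lappL X (u ↓[ E ])) (R ↓[ C ])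
  t↓≡ = trans (trans (cong _↓ et) (plug-↓[] C R hole)) (cong (λ P → lplug P (R ↓[ C ])) C↓≡)

UsefulAt-plug : ∀ {t C} → UsefulAt t C → Σ Tm λ x → t ≡ plug C x
UsefulAt-plug (dB (_ , _ , _ , e))             = _ , e
UsefulAt-plug (ls _ (_ , _ , _ , _ , e , _) _) = _ , e

origin-respects-≺LO : ∀ {t C L s q C′ D′} → t ≡ plug C (dBRedex L s q) → BetaRedexAt (t ↓) D′ →
                      UsefulAt t C′ → Origin hole t C′ D′ → C′ ≡ C ⊎ C ≺LO C′ →
                      D′ ≡ C ↓C[ hole ] ⊎ C ↓C[ hole ] ≺LOΛ D′
origin-respects-≺LO et red useful origin (inj₁ refl) = Sum.map₂ inj₁ (origin-at-dBRedex et origin)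
origin-respects-≺LO et red useful origin (inj₂ (inj₁ (outer _ _ G≢□))) =
  inj₂ (inj₁ (origin-below-dBRedex et (proj₂ (UsefulAt-plug useful)) G≢□ origin))
origin-respects-≺LO et red useful origin (inj₂ (inj₂ (left _ _ _ _ _ _ _))) =
  inj₂ (inj₂ (origin-right-of-position _ et red origin))

mainTheorem15 : ∀ (t u : Tm) (C : Ctx) (L : SubCtx) (s q : Tm) →
    t ≡ plug C (dBRedex L s q) →
    u ≡ plug C (dBContractum L s q) →
    ((t ↓ ≡ lplug (C ↓C) (dBRedex L s q ↓[ C ]))
      × (u ↓ ≡ lplug (C ↓C) (dBContractum L s q ↓[ C ]))
      × RootBeta (dBRedex L s q ↓[ C ]) (dBContractum L s q ↓[ C ]))
    × (IsLOU t C → IsLOBeta (t ↓) (C ↓C))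
mainTheorem15 t u C L s q et eu = (t↓ , u↓ , dB-↓[]-rootBeta C L s q) , leftmostOutermost
  where
  t↓ = trans (cong _↓ et) (plug-↓ C (dBRedex L s q))
  u↓ = trans (cong _↓ eu) (plug-↓ C (dBContractum L s q))
  leftmostOutermost : IsLOU t C → IsLOBeta (t ↓) (C ↓C)
  leftmostOutermost (_ , least) = (_ , _ , trans t↓ (cong (lplug (C ↓C)) (dBRedex-↓[] C L s q))) , minimal
    where
    minimal : ∀ D′ → BetaRedexAt (t ↓) D′ → D′ ≡ C ↓C ⊎ (C ↓C) ≺LOΛ D′
    minimal D′ red =
      let (C′ , useful , origin) = usefulSource t hole D′ red
      in subst (λ P → D′ ≡ P ⊎ P ≺LOΛ D′) (↓C[hole] C) (origin-respects-≺LO et red useful origin (least C′ useful))
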